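{- Let $\Gamma$ be a graph, $n\ge1$, and $\omega\colon E(\Gamma)\to\mathbb{Z}_n$. Let $W=(u_0,\dots,u_k)$ be a closed walk of odd length $k$ in $\Gamma$. Let $i\in\{0,\dots,n-1\}$ and set $a=1$ if $\omega(W)\equiv 2i\pmod n$ and $a=2$ otherwise. Then for every positive integer $b$, the lift of $W^b$ based at $(u_0,i)$ is closed if and only if $a\mid b$.
   Context: For a graph $\Gamma$ and a function (weight function) $\omega\colon E(\Gamma)\to\mathbb{Z}_n$, the cross-cover $\Gamma^\omega$ is the graph with vertex set $V(\Gamma)\times\mathbb{Z}_n$ in which, for every edge $e=uv$ of $\Gamma$ and every $i\in\mathbb{Z}_n$, the vertices $(u,i)$ and $(v,\omega(e)-i)$ are adjacent. A walk $W=(u_0,\dots,u_k)$ is a sequence of vertices with consecutive ones adjacent; it is closed if $u_0=u_k$; $W^b$ is the concatenation of $b$ copies of a closed walk $W$. With $e_j=u_ju_{j+1}$, the weight of $W$ is $\omega(W)=\sum_{j=0}^{k-1}(-1)^j\omega(e_j)$. The lift of $W$ based at $(u_0,i)$ is the walk $((u_0,i),(u_1,\omega(e_0)-i),(u_2,\omega(e_1)-\omega(e_0)+i),\dots)$ of $\Gamma^\omega$, i.e. the walk starting at $(u_0,i)$ whose $j$-th vertex lies over $u_j$ and which uses at each step the edge over $e_j$; its last vertex is $(u_k,(-1)^k(i-\omega(W)))$. -}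

module Defs where

open import Data.Nat as ℕ using (ℕ; zero; suc; NonZero)
open import Data.Integer as ℤ using (ℤ; +_; _%ℕ_)
open import Data.Integer.DivMod using (n%ℕd<d)
open import Data.Fin using (Fin; toℕ; fromℕ<)
open import Data.Product using (Σ; _×_; _,_)
open import Relation.Binary.PropositionalEquality using (_≡_; refl)

-- ℤ_n represented by Fin n (canonical representatives 0 … n-1),
-- with arithmetic done modulo n via ℤ.
module Zn (n : ℕ) .{{_ : NonZero n}} where
  ⟦_⟧ : ℤ → Fin n
  ⟦ z ⟧ = fromℕ< (n%ℕd<d z n)

  toℤ : Fin n → ℤ
  toℤ x = + (toℕ x)

  0ₙ : Fin n
  0ₙ = ⟦ + 0 ⟧

  _+ₙ_ : Fin n → Fin n → Fin n
  x +ₙ y = ⟦ toℤ x ℤ.+ toℤ y ⟧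

  _-ₙ_ : Fin n → Fin n → Fin n
  x -ₙ y = ⟦ toℤ x ℤ.- toℤ y ⟧

record Graph : Set₁ where
  field
    V       : Set
    Adj     : V → V → Set
    Adj-sym : ∀ {u v} → Adj u v → Adj v u

data Walk {V : Set} (R : V → V → Set) : V → V → Set where
  []  : ∀ {u} → Walk R u u
  _∷_ : ∀ {u w v} → R u w → Walk R w v → Walk R u v

infixr 5 _∷_

module _ {V : Set} {R : V → V → Set} where
  length : ∀ {u v} → Walk R u v → ℕ
  length []      = 0
  length (_ ∷ W) = suc (length W)

  _++_ : ∀ {u v w} → Walk R u v → Walk R v w → Walk R u w
  []      ++ W' = W'
  (p ∷ W) ++ W' = p ∷ (W ++ W')

  _^_ : ∀ {u} → Walk R u u → ℕ → Walk R u u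
  W ^ zero  = []
  W ^ suc b = W ++ (W ^ b)

  IsClosed : ∀ {u v} → Walk R u v → Set
  IsClosed {u} {v} _ = u ≡ v

-- A weight function ω : E(Γ) → ℤ_n. Since an edge uv is the same as vu,
-- ω takes the same value on both orientations (and on every adjacency witness).
record Weight (Γ : Graph) (n : ℕ) : Set where
  open Graph Γ
  field
    ω     : ∀ {u v} → Adj u v → Fin n
    ω-sym : ∀ {u v} (p : Adj u v) (q : Adj v u) → ω p ≡ ω q

module _ {Γ : Graph} {n : ℕ} .{{_ : NonZero n}} (wt : Weight Γ n) where
  open Graph Γ
  open Weight wt
  open Zn n

  -- ω(W) = Σ_j (-1)^j ω(e_j)
  weight : ∀ {u v} → Walk Adj u v → Fin n
  weight []      = 0ₙ
  weight (p ∷ W) = ω p -ₙ weight W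

  CCAdj : V × Fin n → V × Fin n → Set
  CCAdj (u , i) (v , j) = Σ (Adj u v) (λ e → j ≡ ω e -ₙ i)

  liftEnd : ∀ {u v} → Walk Adj u v → Fin n → Fin n
  liftEnd []      i = i
  liftEnd (e ∷ W) i = liftEnd W (ω e -ₙ i)

  lift : ∀ {u v} (W : Walk Adj u v) (i : Fin n) → Walk CCAdj (u , i) (v , liftEnd W i)
  lift []      i = []
  lift (e ∷ W) i = (e , refl) ∷ lift W (ω e -ₙ i)

{-# OPTIONS --safe #-}
module Submission where

-- Along an edge e the fibre coordinate changes by i ↦ ω(e) − i, so the lift of a walk of
-- length k ends at (−1)^k (i − ω(W)) mod n. For odd k the lift of W therefore acts on the
-- fibre over u₀ as the involution σ(i) = ω(W) − i, and the lift of W^b as σ^b. The orbit of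
-- i under an involution returns to i for every b if σ(i) = i, i.e. ω(W) = 2i, and otherwise
-- exactly for even b.

open import Defs
open import Algebra.Definitions using (Involutive)
open import Data.Bool using (if_then_else_)
open import Data.Fin using (Fin; _≟_; toℕ)
open import Data.Fin.Properties using (toℕ-fromℕ<; toℕ-injective; toℕ<n)
open import Data.Integer as ℤ using (ℤ; +_; 1ℤ; -1ℤ; _/ℕ_; _+_; _-_; _*_; -_)
import Data.Integer.Properties as ℤ
open import Data.Integer.DivMod using (a≡a%ℕn+[a/ℕn]*n)
open import Data.Integer.Divisibility.Signed as Signed
  using (divides; ∣⇒∣ᵤ; ∣m∣n⇒∣m+n; ∣m∣n⇒∣m-n; ∣m⇒∣-m; ∣n⇒∣m*n)
open import Data.Integer.Tactic.RingSolver using (solve-∀)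
open import Data.Nat as ℕ using (ℕ; NonZero; zero; suc; s≤s; _%_; _≥_)
import Data.Nat.Properties as ℕ
open import Data.Nat.DivMod using (m%n<n; m<n⇒m%n≡m)
open import Data.Nat.Divisibility using (_∣_; 1∣_; n∣m⇒m%n≡0; m%n≡0⇔n∣m)
open import Data.Product using (_,_)
open import Data.Product.Properties using (,-injectiveʳ)
open import Function using (_∘_)
open import Function.Bundles using (_⇔_; mk⇔; Equivalence)
open import Function.Construct.Composition using (_⇔-∘_)
import Function.Endo.Propositional as Endo
open import Level using (0ℓ)
open import Relation.Binary.Bundles using (Setoid)
open import Relation.Binary.PropositionalEquality
  using (_≡_; _≢_; refl; sym; trans; cong; subst; module ≡-Reasoning)
open import Relation.Binary.Structures using (IsEquivalence)
import Relation.Binary.Reasoning.Setoid as SetoidReasoning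
open import Relation.Nullary using (Dec; yes; no; contradiction)
open import Relation.Nullary.Decidable using (⌊_⌋)

m∣n∧n<m⇒n≡0 : ∀ {m n} .{{_ : NonZero m}} → m ∣ n → n ℕ.< m → n ≡ 0
m∣n∧n<m⇒n≡0 {m} {n} m∣n n<m = trans (sym (m<n⇒m%n≡m n<m)) (n∣m⇒m%n≡0 n m m∣n)

module ZnProperties (n : ℕ) .{{_ : NonZero n}} where
  open Zn n

  -- A record rather than a function into Set, so that both sides can be inferred.
  infix 4 _≈_
  record _≈_ (a b : ℤ) : Set where
    constructor mod
    field n∣a-b : + n Signed.∣ a - b

  ≈-isEquivalence : IsEquivalence _≈_
  ≈-isEquivalence = record
    { refl  = λ {a} → mod (subst (+ n Signed.∣_) (sym (ℤ.+-inverseʳ a)) (divides (+ 0) refl))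
    ; sym   = λ {a} {b} (mod p) → mod (subst (+ n Signed.∣_) (negate-diff a b) (∣m⇒∣-m p))
    ; trans = λ {a} {b} {c} (mod p) (mod q) →
                mod (subst (+ n Signed.∣_) (chain-diff a b c) (∣m∣n⇒∣m+n p q))
    }
    where
    negate-diff : ∀ a b → - (a - b) ≡ b - a
    negate-diff = solve-∀
    chain-diff : ∀ a b c → (a - b) + (b - c) ≡ a - c
    chain-diff = solve-∀

  ≈-setoid : Setoid 0ℓ 0ℓ
  ≈-setoid = record { isEquivalence = ≈-isEquivalence }

  open IsEquivalence ≈-isEquivalence public using () renaming (refl to ≈-refl)

  +-cong : ∀ {a a′ b b′} → a ≈ a′ → b ≈ b′ → a + b ≈ a′ + b′
  +-cong {a} {a′} {b} {b′} (mod p) (mod q) =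
    mod (subst (+ n Signed.∣_) (sum-diff a a′ b b′) (∣m∣n⇒∣m+n p q))
    where
    sum-diff : ∀ a a′ b b′ → (a - a′) + (b - b′) ≡ (a + b) - (a′ + b′)
    sum-diff = solve-∀

  -cong : ∀ {a a′ b b′} → a ≈ a′ → b ≈ b′ → a - b ≈ a′ - b′
  -cong {a} {a′} {b} {b′} (mod p) (mod q) =
    mod (subst (+ n Signed.∣_) (diff-diff a a′ b b′) (∣m∣n⇒∣m-n p q))
    where
    diff-diff : ∀ a a′ b b′ → (a - a′) - (b - b′) ≡ (a - b) - (a′ - b′)
    diff-diff = solve-∀

  *-congˡ : ∀ c {a a′} → a ≈ a′ → c * a ≈ c * a′
  *-congˡ c {a} {a′} (mod p) = mod (subst (+ n Signed.∣_) (scale-diff c a a′) (∣n⇒∣m*n c p))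
    where
    scale-diff : ∀ c a a′ → c * (a - a′) ≡ c * a - c * a′
    scale-diff = solve-∀

  toℤ-⟦⟧ : ∀ z → toℤ ⟦ z ⟧ ≈ z
  toℤ-⟦⟧ z = mod (divides (- q) (begin
    toℤ ⟦ z ⟧ - z     ≡⟨ cong (λ r → + r - z) (toℕ-fromℕ< _) ⟩
    r - z             ≡⟨ cong (λ m → r - m) (a≡a%ℕn+[a/ℕn]*n z n) ⟩
    r - (r + q * + n) ≡⟨ cancel r q (+ n) ⟩
    - q * + n         ∎))
    where
    open ≡-Reasoning
    r = + (z ℤ.%ℕ n)
    q = z /ℕ n
    cancel : ∀ r q m → r - (r + q * m) ≡ - q * m
    cancel = solve-∀

  toℤ-injective-mod : ∀ {x y} → toℤ x ≈ toℤ y → x ≡ y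
  toℤ-injective-mod {x} {y} (mod n∣x-y) =
    toℕ-injective (ℤ.+-injective (ℤ.i-j≡0⇒i≡j _ _ (ℤ.∣i∣≡0⇒i≡0 distance≡0)))
    where
    a = toℕ x
    b = toℕ y
    distance<n : ℤ.∣ + a - + b ∣ ℕ.< n
    distance<n = begin-strict
      ℤ.∣ + a - + b ∣ ≡⟨ cong ℤ.∣_∣ (ℤ.m-n≡m⊖n a b) ⟩
      ℤ.∣ a ℤ.⊖ b ∣   ≤⟨ ℤ.∣m⊝n∣≤m⊔n a b ⟩
      a ℕ.⊔ b         <⟨ ℕ.⊔-lub (toℕ<n x) (toℕ<n y) ⟩
      n               ∎
      where open ℕ.≤-Reasoning
    distance≡0 : ℤ.∣ + a - + b ∣ ≡ 0
    distance≡0 = m∣n∧n<m⇒n≡0 (∣⇒∣ᵤ n∣x-y) distance<n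

  toℤ-0ₙ : toℤ 0ₙ ≈ + 0
  toℤ-0ₙ = toℤ-⟦⟧ (+ 0)

  toℤ-+ₙ : ∀ x y → toℤ (x +ₙ y) ≈ toℤ x + toℤ y
  toℤ-+ₙ x y = toℤ-⟦⟧ _

  toℤ--ₙ : ∀ x y → toℤ (x -ₙ y) ≈ toℤ x - toℤ y
  toℤ--ₙ x y = toℤ-⟦⟧ _

  -ₙ-involutive : ∀ w → Involutive _≡_ (w -ₙ_)
  -ₙ-involutive w i = toℤ-injective-mod (begin
    toℤ (w -ₙ (w -ₙ i))     ≈⟨ toℤ--ₙ w (w -ₙ i) ⟩
    toℤ w - toℤ (w -ₙ i)    ≈⟨ -cong (≈-refl {toℤ w}) (toℤ--ₙ w i) ⟩
    toℤ w - (toℤ w - toℤ i) ≡⟨ sub-sub (toℤ w) (toℤ i) ⟩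
    toℤ i                   ∎)
    where
    open SetoidReasoning ≈-setoid
    sub-sub : ∀ a b → a - (a - b) ≡ b
    sub-sub = solve-∀

  ≡+ₙ⇔-ₙ≡ : ∀ x y z → x ≡ z +ₙ y ⇔ x -ₙ y ≡ z
  ≡+ₙ⇔-ₙ≡ x y z = mk⇔ to from
    where
    open SetoidReasoning ≈-setoid
    add-sub : ∀ a b → a + b - b ≡ a
    add-sub = solve-∀
    sub-add : ∀ a b → a ≡ a - b + b
    sub-add = solve-∀

    to : x ≡ z +ₙ y → x -ₙ y ≡ z
    to refl = toℤ-injective-mod (begin
      toℤ ((z +ₙ y) -ₙ y)   ≈⟨ toℤ--ₙ (z +ₙ y) y ⟩
      toℤ (z +ₙ y) - toℤ y  ≈⟨ -cong (toℤ-+ₙ z y) (≈-refl {toℤ y}) ⟩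
      toℤ z + toℤ y - toℤ y ≡⟨ add-sub (toℤ z) (toℤ y) ⟩
      toℤ z                 ∎)

    from : x -ₙ y ≡ z → x ≡ z +ₙ y
    from refl = toℤ-injective-mod (begin
      toℤ x                 ≡⟨ sub-add (toℤ x) (toℤ y) ⟩
      toℤ x - toℤ y + toℤ y ≈⟨ +-cong (toℤ--ₙ x y) (≈-refl {toℤ y}) ⟨
      toℤ (x -ₙ y) + toℤ y  ≈⟨ toℤ-+ₙ (x -ₙ y) y ⟨
      toℤ ((x -ₙ y) +ₙ y)   ∎)

-1ℤ^odd : ∀ k → k % 2 ≡ 1 → -1ℤ ℤ.^ k ≡ -1ℤ
-1ℤ^odd 1             _     = refl
-1ℤ^odd (suc (suc k)) k%2≡1 rewrite -1ℤ^odd k k%2≡1 = refl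

module _ {a} {A : Set a} where
  open Endo A using () renaming (_^_ to iterate)

  iterate-sucʳ : ∀ (σ : A → A) b x → iterate σ (suc b) x ≡ iterate σ b (σ x)
  iterate-sucʳ σ zero    x = refl
  iterate-sucʳ σ (suc b) x = cong σ (iterate-sucʳ σ b x)

  iterate-fixedPoint : ∀ {σ : A → A} {x} → σ x ≡ x → ∀ b → iterate σ b x ≡ x
  iterate-fixedPoint σx≡x zero    = refl
  iterate-fixedPoint {σ} σx≡x (suc b) = trans (cong σ (iterate-fixedPoint σx≡x b)) σx≡x

  module _ (σ : A → A) (σ-involutive : Involutive _≡_ σ) where

    iterate-%2 : ∀ b x → iterate σ b x ≡ iterate σ (b % 2) x
    iterate-%2 zero          x = refl
    iterate-%2 (suc zero)    x = refl
    -- (2 + b) % 2 reduces to b % 2 definitionally.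
    iterate-%2 (suc (suc b)) x = trans (σ-involutive _) (iterate-%2 b x)

    iterate-returns⇔even : ∀ {x} → σ x ≢ x → ∀ b → iterate σ b x ≡ x ⇔ b % 2 ≡ 0
    iterate-returns⇔even {x} σx≢x b with b % 2 | iterate-%2 b x | m%n<n b 2
    ... | zero        | σᵇx≡x  | _ = mk⇔ (λ _ → refl) (λ _ → σᵇx≡x)
    ... | suc zero    | σᵇx≡σx | _ =
      mk⇔ (λ σᵇx≡x → contradiction (trans (sym σᵇx≡σx) σᵇx≡x) σx≢x) λ ()
    ... | suc (suc _) | _      | s≤s (s≤s ())

    iterate-returns⇔ : ∀ {p} {P : Set p} {x} → P ⇔ (σ x ≡ x) → (P? : Dec P) → ∀ b →
                       iterate σ b x ≡ x ⇔ (if ⌊ P? ⌋ then 1 else 2) ∣ b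
    iterate-returns⇔ P⇔σx≡x (yes P-holds) b =
      mk⇔ (λ _ → 1∣ b) (λ _ → iterate-fixedPoint (Equivalence.to P⇔σx≡x P-holds) b)
    iterate-returns⇔ P⇔σx≡x (no ¬P) b =
      m%n≡0⇔n∣m b 2 ⇔-∘ iterate-returns⇔even (¬P ∘ Equivalence.from P⇔σx≡x) b

module _ {Γ : Graph} {n : ℕ} .{{_ : NonZero n}} (wt : Weight Γ n) where
  open Graph Γ
  open Weight wt
  open Zn n
  open ZnProperties n
  open Endo (Fin n) using () renaming (_^_ to iterate)

  liftEnd-++ : ∀ {u v w} (W : Walk Adj u v) (W′ : Walk Adj v w) i →
               liftEnd wt (W ++ W′) i ≡ liftEnd wt W′ (liftEnd wt W i)
  liftEnd-++ []      W′ i = refl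
  liftEnd-++ (e ∷ W) W′ i = liftEnd-++ W W′ (ω e -ₙ i)

  toℤ-liftEnd : ∀ {u v} (W : Walk Adj u v) i →
                toℤ (liftEnd wt W i) ≈ -1ℤ ℤ.^ length W * (toℤ i - toℤ (weight wt W))
  toℤ-liftEnd [] i = begin
    toℤ i                 ≡⟨ unit (toℤ i) ⟩
    1ℤ * (toℤ i - + 0)    ≈⟨ *-congˡ 1ℤ (-cong (≈-refl {toℤ i}) toℤ-0ₙ) ⟨
    1ℤ * (toℤ i - toℤ 0ₙ) ∎
    where
    open SetoidReasoning ≈-setoid
    unit : ∀ a → a ≡ 1ℤ * (a - + 0)
    unit = solve-∀
  toℤ-liftEnd (e ∷ W) i = begin
    toℤ (liftEnd wt W (ω e -ₙ i))                ≈⟨ toℤ-liftEnd W (ω e -ₙ i) ⟩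
    s * (toℤ (ω e -ₙ i) - w)                     ≈⟨ *-congˡ s (-cong (toℤ--ₙ (ω e) i) ≈-refl) ⟩
    s * (o - toℤ i - w)                          ≡⟨ flip-sign s o (toℤ i) w ⟩
    -1ℤ * s * (toℤ i - (o - w))                  ≈⟨ *-congˡ (-1ℤ * s) (-cong (≈-refl {toℤ i}) o-w) ⟨
    -1ℤ * s * (toℤ i - toℤ (ω e -ₙ weight wt W)) ∎
    where
    open SetoidReasoning ≈-setoid
    s = -1ℤ ℤ.^ length W
    o = toℤ (ω e)
    w = toℤ (weight wt W)
    o-w : toℤ (ω e -ₙ weight wt W) ≈ o - w
    o-w = toℤ--ₙ (ω e) (weight wt W)
    flip-sign : ∀ s o i w → s * (o - i - w) ≡ -1ℤ * s * (i - (o - w))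
    flip-sign = solve-∀

  liftEnd-odd : ∀ {u v} (W : Walk Adj u v) → length W % 2 ≡ 1 → ∀ i →
                liftEnd wt W i ≡ weight wt W -ₙ i
  liftEnd-odd W odd i = toℤ-injective-mod (begin
    toℤ (liftEnd wt W i)               ≈⟨ toℤ-liftEnd W i ⟩
    -1ℤ ℤ.^ length W * (toℤ i - toℤ w) ≡⟨ cong (_* (toℤ i - toℤ w)) (-1ℤ^odd (length W) odd) ⟩
    -1ℤ * (toℤ i - toℤ w)              ≡⟨ negate-diff (toℤ i) (toℤ w) ⟩
    toℤ w - toℤ i                      ≈⟨ toℤ--ₙ w i ⟨
    toℤ (w -ₙ i)                       ∎)
    where
    open SetoidReasoning ≈-setoid
    w = weight wt W
    negate-diff : ∀ i w → -1ℤ * (i - w) ≡ w - i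
    negate-diff = solve-∀

  liftEnd-^ : ∀ {u} (W : Walk Adj u u) → length W % 2 ≡ 1 → ∀ b i →
              liftEnd wt (W ^ b) i ≡ iterate (weight wt W -ₙ_) b i
  liftEnd-^ W odd zero    i = refl
  liftEnd-^ W odd (suc b) i = begin
    liftEnd wt (W ++ (W ^ b)) i         ≡⟨ liftEnd-++ W (W ^ b) i ⟩
    liftEnd wt (W ^ b) (liftEnd wt W i) ≡⟨ cong (liftEnd wt (W ^ b)) (liftEnd-odd W odd i) ⟩
    liftEnd wt (W ^ b) (σ i)            ≡⟨ liftEnd-^ W odd b (σ i) ⟩
    iterate σ b (σ i)                   ≡⟨ iterate-sucʳ σ b i ⟨
    iterate σ (suc b) i                 ∎
    where
    open ≡-Reasoning
    σ = weight wt W -ₙ_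

  isClosed-lift⇔ : ∀ {u} (W : Walk Adj u u) i → IsClosed (lift wt W i) ⇔ liftEnd wt W i ≡ i
  isClosed-lift⇔ {u} W i = mk⇔ (sym ∘ ,-injectiveʳ) (cong (u ,_) ∘ sym)

  isClosed-lift-^⇔ : ∀ {u} (W : Walk Adj u u) → length W % 2 ≡ 1 → ∀ b i →
                     IsClosed (lift wt (W ^ b) i) ⇔ iterate (weight wt W -ₙ_) b i ≡ i
  isClosed-lift-^⇔ W odd b i =
    subst (λ j → IsClosed (lift wt (W ^ b) i) ⇔ j ≡ i) (liftEnd-^ W odd b i)
          (isClosed-lift⇔ (W ^ b) i)

lemma3p4 : (Γ : Graph) (n : ℕ) .{{_ : NonZero n}} (wt : Weight Γ n)
           {u₀ : Graph.V Γ} (W : Walk (Graph.Adj Γ) u₀ u₀) →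
           length W % 2 ≡ 1 →
           (i : Fin n) →
           let a = if ⌊ weight wt W ≟ Zn._+ₙ_ n i i ⌋ then 1 else 2
           in (b : ℕ) → b ≥ 1 → IsClosed (lift wt (W ^ b) i) ⇔ (a ∣ b)
-- The statement also holds for b = 0.
lemma3p4 Γ n wt W odd i b _ =
  iterate-returns⇔ (w -ₙ_) (-ₙ-involutive w) (≡+ₙ⇔-ₙ≡ w i i) (w ≟ i +ₙ i) b
    ⇔-∘ isClosed-lift-^⇔ wt W odd b i
  where
  open Zn n
  open ZnProperties n
  w = weight wt W
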